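{- Let $D$ be a finite set, $R\subseteq D^n$, $\rho:R\to\mathbb{Q}_+$ a weighted relation, and let $\mathbb{D}$ and $u:V^{\mathbb{D}}\to\mathbb{Q}_+$ be constructed from $\rho$ as in the context. Let $w\mathbb{A}_0$ be the weighted structure with domain $V^{\mathbb{D}}$ consisting of the binary weighted relation $E^{\mathbb{D}}$ (the edge relation of $\mathbb{D}$ with every edge having weight $0$) and the unary weighted relation $u$ (defined on all of $V^{\mathbb{D}}$). Then the weighted structure $w\mathbb{A}$ on $D$ with single weighted relation $\rho$ is expressible by $w\mathbb{A}_0$; namely, both $\rho$ (regarded as a weighted relation on $V^{\mathbb{D}}\supseteq D$) and the domain $D$ (regarded as a unary weighted relation with all weights $0$) are expressible by $w\mathbb{A}_0$.
   Context: A weighted relation $\rho:R\to\mathbb{Q}_+$ ($\mathbb{Q}_+$ the non-negative rationals) is a function from a relation $R$ to $\mathbb{Q}_+$. A weighted structure is a finite domain with a finite list of weighted relations (indexed by a relational signature $\tau$); an instance of $\mathrm{VCSP}(w\mathbb{A}_0)$ is a weighted $\tau$-structure $w\mathbb{X}$ with domain $X$, feasible solutions are homomorphisms $h$ of the underlying relational structures $\mathbb{X}\to\mathbb{A}_0$, with $cost(h)=\sum_{R\in\tau,\mathbf{x}\in R^{\mathbb{X}}}\rho^{w\mathbb{X}}(\mathbf{x})\cdot\rho^{w\mathbb{A}_0}(h(\mathbf{x}))$. For such an instance and a tuple $W=(x_1,\dots,x_t)$ of distinct elements of $X$, define $\rho^W_{w\mathbb{X}}(a_1,\dots,a_t)=\min\{cost(h):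 h:\mathbb{X}\to\mathbb{A}_0,\ h(x_i)=a_i \text{ for all } i\}$, undefined if no such $h$ exists. A weighted relation is expressible by $w\mathbb{A}_0$ if it equals $\rho^W_{w\mathbb{X}}$ for some instance $w\mathbb{X}$ and some such $W$. Construction: a single edge is $\bullet\to\bullet$, a zigzag is $\bullet\to\bullet\leftarrow\bullet\to\bullet$. For $S\subseteq\{1,\dots,n\}$, $Q_{S,l}$ is a single edge if $l\in S$ and a zigzag otherwise, and $Q_S$ is the concatenation (terminal vertex of each piece identified with the initial vertex of the next) of a single edge, $Q_{S,1},\dots,Q_{S,n}$, and a single edge. $\mathbb{D}$ has vertex set $D\cup R$ plus new vertices: for each $(d,\mathbf{a})\in D\times R$ add a copy of $Q_{\{i:d=a_i\}}$ from $d$ (initial vertex) to $\mathbf{a}$ (terminal vertex) with fresh internal vertices. Define $u(v)=\rho(v)$ if $v\in R$ and $u(v)=0$ otherwise. -}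

module Defs where

open import Data.Nat using (ℕ; zero; suc)
open import Data.Fin using (Fin; zero; suc; inject₁; fromℕ; _≟_)
open import Data.Vec using (Vec; lookup; map; [_])
open import Data.Bool using (Bool; true; false; T; not)
open import Data.Rational using (ℚ; 0ℚ; _≤_; _+_; _*_)
open import Data.Product using (Σ; _×_; _,_; proj₁)
open import Data.Unit using (⊤)
open import Relation.Nullary using (¬_; does)
open import Relation.Binary.PropositionalEquality using (_≡_)

∑ : (m : ℕ) → (Fin m → ℚ) → ℚ
∑ zero f = 0ℚ
∑ (suc m) f = f zero + ∑ m (λ i → f (suc i))

when : Bool → ℚ → ℚ
when true q = q
when false q = 0ℚ

record Structure0 : Set₁ where
  field
    Carrier : Set
    Edge    : Carrier → Carrier → Set
    wE      : Carrier → Carrier → ℚ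
    Un      : Carrier → Set
    wU      : Carrier → ℚ

record Instance : Set where
  field
    m         : ℕ
    E         : Fin m → Fin m → Bool
    wE        : Fin m → Fin m → ℚ
    U         : Fin m → Bool
    wU        : Fin m → ℚ
    wE-nonneg : ∀ x y → T (E x y) → 0ℚ ≤ wE x y
    wU-nonneg : ∀ x → T (U x) → 0ℚ ≤ wU x

module _ (A : Structure0) (I : Instance) where
  private
    module A = Structure0 A
    module I = Instance I

  IsHom : (Fin I.m → A.Carrier) → Set
  IsHom h = (∀ x y → T (I.E x y) → A.Edge (h x) (h y))
          × (∀ x → T (I.U x) → A.Un (h x))

  cost : (Fin I.m → A.Carrier) → ℚ
  cost h = ∑ I.m (λ x → ∑ I.m (λ y → when (I.E x y) (I.wE x y * A.wE (h x) (h y))))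
         + ∑ I.m (λ x → when (I.U x) (I.wU x * A.wU (h x)))

  Extends : ∀ {t} → Vec (Fin I.m) t → Vec A.Carrier t → (Fin I.m → A.Carrier) → Set
  Extends W a h = ∀ i → h (lookup W i) ≡ lookup a i

  Feasible : ∀ {t} → Vec (Fin I.m) t → Vec A.Carrier t → Set
  Feasible W a = Σ (Fin I.m → A.Carrier) λ h → IsHom h × Extends W a h

  IsMinCost : ∀ {t} → Vec (Fin I.m) t → Vec A.Carrier t → ℚ → Set
  IsMinCost W a q =
    (Σ (Fin I.m → A.Carrier) λ h → IsHom h × Extends W a h × (cost h ≡ q))
    × (∀ h → IsHom h → Extends W a h → q ≤ cost h)

  Distinct : ∀ {t} → Vec (Fin I.m) t → Set
  Distinct W = ∀ i j → lookup W i ≡ lookup W j → i ≡ j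

  -- A weighted relation of arity t on A, given by its graph
  -- Val : Vec Carrier t → ℚ → Set (Val a q ⇔ defined at a with value q),
  -- equals ρ^W_{wX}.
  Expresses : ∀ {t} → Vec (Fin I.m) t → (Vec A.Carrier t → ℚ → Set) → Set
  Expresses {t} W Val = ∀ (a : Vec A.Carrier t) →
    (∀ q → Val a q → IsMinCost W a q)
    × ((∀ q → ¬ Val a q) → ¬ Feasible W a)

Expressible : (A : Structure0) (t : ℕ) → (Vec (Structure0.Carrier A) t → ℚ → Set) → Set
Expressible A t Val =
  Σ Instance λ I → Σ (Vec (Fin (Instance.m I)) t) λ W →
    Distinct A I W × Expresses A I W Val

module Gadget {d n : ℕ} (R : Vec (Fin d) n → Bool)
              (ρ : Σ (Vec (Fin d) n) (λ a → T (R a)) → ℚ) where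

  RElem : Set
  RElem = Σ (Vec (Fin d) n) (λ a → T (R a))

  -- l ∈ S for the path Q_S from x to a, S = {i : x = a_i}
  inS : Fin d → RElem → Fin n → Bool
  inS x (a , _) l = does (x ≟ lookup a l)

  -- Vertices: D, R, and fresh internal vertices of each copy of Q_S.
  -- In the copy from x to a: pv x a k (k = 0..n) are the junction vertices
  -- (pv x a 0 after the first single edge; piece l goes from
  -- pv x a l to pv x a (l+1); the last single edge goes from pv x a n to a);
  -- zA, zB are the two middle vertices of the zigzag for piece l ∉ S.
  data V : Set where
    dv : Fin d → V
    rv : RElem → V
    pv : Fin d → RElem → Fin (suc n) → V
    zA : (x : Fin d) (a : RElem) (l : Fin n) → T (not (inS x a l)) → V
    zB : (x : Fin d) (a : RElem) (l : Fin n) → T (not (inS x a l)) → V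

  data Edge : V → V → Set where
    e-first  : ∀ x a → Edge (dv x) (pv x a zero)
    e-last   : ∀ x a → Edge (pv x a (fromℕ n)) (rv a)
    e-single : ∀ x a l → T (inS x a l) → Edge (pv x a (inject₁ l)) (pv x a (suc l))
    e-zig1   : ∀ x a l (p : T (not (inS x a l))) → Edge (pv x a (inject₁ l)) (zA x a l p)
    e-zig2   : ∀ x a l (p : T (not (inS x a l))) → Edge (zB x a l p) (zA x a l p)
    e-zig3   : ∀ x a l (p : T (not (inS x a l))) → Edge (zB x a l p) (pv x a (suc l))

  u : V → ℚ
  u (rv a) = ρ a
  u _ = 0ℚ

  A0 : Structure0
  A0 = record { Carrier = V ; Edge = Edge ; wE = λ _ _ → 0ℚ
              ; Un = λ _ → ⊤ ; wU = u }

  ρVal : Vec V n → ℚ → Set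
  ρVal v q = Σ RElem λ a → (v ≡ map dv (proj₁ a)) × (ρ a ≡ q)

  DVal : Vec V 1 → ℚ → Set
  DVal v q = Σ (Fin d) λ x → (v ≡ [ dv x ]) × (q ≡ 0ℚ)

-- In 𝔻 every edge raises the level lev by exactly one, D is the bottom level and R the top level
-- n + 2.  The instance for ρ joins a vertex X i for each coordinate i to a common vertex Y by a
-- copy of the path Q_{i}, which rises n + 2 levels, and weights Y alone.  A homomorphic image of such a path
-- therefore climbs from some x ∈ D to some a ∈ R, and, one piece at a time, it has to follow the
-- copy of Q_{l : x = a_l} from x to a; the single edge at position i then forces x = a_i.  So a
-- feasible solution is determined by the tuple a = h(Y), maps X to a and costs exactly ρ(a); and
-- every a ∈ R is reached by mapping the paths onto these copies.  D is expressed in the same way by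
-- one all-zigzag path, whose start is forced into D.  If R = ∅ (resp. D = ∅), every vertex of 𝔻
-- lies in D (resp. R) and instances without paths suffice.

module Submission where

open import Defs
open import Data.Nat using (ℕ; zero; suc)
import Data.Nat as ℕ
import Data.Nat.Properties as ℕₚ
open import Data.Fin using (Fin; zero; suc; inject₁; fromℕ; toℕ; _≟_)
open import Data.Fin.Properties
  using (+↔⊎; *↔×; 1↔⊤; fromℕ≢inject₁; inject₁-injective; toℕ-inject₁; toℕ-fromℕ; toℕ≤pred[n]; toℕ<n; suc-injective; any?)
open import Data.Fin.Induction using (<-weakInduction; >-weakInduction)
open import Data.Vec using (Vec; []; _∷_; lookup; map; tabulate; [_])
open import Data.Vec.Properties using (∷-injective; lookup∘tabulate; tabulate∘lookup; tabulate-cong; lookup-map)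
open import Data.Bool using (Bool; true; false; T; not)
open import Data.Bool.Properties using (T?; T-irrelevant)
open import Data.Rational using (ℚ; 0ℚ; 1ℚ; _≤_; _+_; _*_)
import Data.Rational.Properties as ℚ
open import Data.Product using (Σ; ∃-syntax; _×_; _,_; proj₁; proj₂)
open import Data.Sum using (_⊎_; inj₁; inj₂)
open import Data.Sum.Function.Propositional using (_⊎-↔_)
open import Data.Unit using (⊤; tt)
open import Data.Empty using (⊥-elim)
open import Function using (_∘_; _↔_; Inverse)
open import Function.Properties.Inverse using (↔-trans; ↔-refl)
open import Relation.Nullary using (¬_; Dec; yes; no)
open import Relation.Nullary.Decidable using (isYes; toWitness; fromWitness; map′; dec-true; _×-dec_)
open import Relation.Binary.PropositionalEquality
  using (_≡_; _≢_; refl; sym; trans; cong; cong₂; subst; subst₂; module ≡-Reasoning)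

∑-cong : ∀ m {f g : Fin m → ℚ} → (∀ i → f i ≡ g i) → ∑ m f ≡ ∑ m g
∑-cong zero    f≡g = refl
∑-cong (suc m) f≡g = cong₂ _+_ (f≡g zero) (∑-cong m (f≡g ∘ suc))

∑-zero : ∀ m → ∑ m (λ _ → 0ℚ) ≡ 0ℚ
∑-zero zero    = refl
∑-zero (suc m) = trans (cong (0ℚ +_) (∑-zero m)) (ℚ.+-identityˡ 0ℚ)

∑-single : ∀ m (f : Fin m → ℚ) y → (∀ x → x ≢ y → f x ≡ 0ℚ) → ∑ m f ≡ f y
∑-single (suc m) f zero vanish = begin
  f zero + ∑ m (f ∘ suc)      ≡⟨ cong (f zero +_) (∑-cong m (λ x → vanish (suc x) λ ())) ⟩
  f zero + ∑ m (λ _ → 0ℚ)     ≡⟨ cong (f zero +_) (∑-zero m) ⟩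
  f zero + 0ℚ                 ≡⟨ ℚ.+-identityʳ (f zero) ⟩
  f zero                      ∎
  where open ≡-Reasoning
∑-single (suc m) f (suc y) vanish = begin
  f zero + ∑ m (f ∘ suc)      ≡⟨ cong (_+ ∑ m (f ∘ suc)) (vanish zero λ ()) ⟩
  0ℚ + ∑ m (f ∘ suc)          ≡⟨ ℚ.+-identityˡ _ ⟩
  ∑ m (f ∘ suc)               ≡⟨ ∑-single m (f ∘ suc) y (λ x x≢y → vanish (suc x) (x≢y ∘ suc-injective)) ⟩
  f (suc y)                   ∎
  where open ≡-Reasoning

map-injective : ∀ {A B : Set} {f : A → B} {k} → (∀ {x y} → f x ≡ f y → x ≡ y) →
                {xs ys : Vec A k} → map f xs ≡ map f ys → xs ≡ ys
map-injective f-inj {[]}     {[]}     _  = refl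
map-injective f-inj {x ∷ xs} {y ∷ ys} eq =
  cong₂ _∷_ (f-inj (proj₁ (∷-injective eq))) (map-injective f-inj (proj₂ (∷-injective eq)))

singleton-distinct : ∀ {A I w} → Distinct A I [ w ]
singleton-distinct zero zero _ = refl

module _ (A : Structure0) (I : Instance) {t} (W : Vec (Fin (Instance.m I)) t)
         (Val : Vec (Structure0.Carrier A) t → ℚ → Set) where

  forcedCost⇒Expresses :
    (∀ a {q q′} → Val a q → Val a q′ → q ≡ q′) →
    (∀ a h → IsHom A I h → Extends A I W a h → ∃[ q ] Val a q × cost A I h ≡ q) →
    (∀ a {q} → Val a q → Feasible A I W a) →
    Expresses A I W Val
  forcedCost⇒Expresses functional forced feasible a = minimal , infeasible
    where
    minimal : ∀ q → Val a q → IsMinCost A I W a q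
    minimal q v with feasible a v
    ... | h , hom , ext with forced a h hom ext
    ...   | q′ , v′ , cost≡q′ = (h , hom , ext , trans cost≡q′ (functional a v′ v)) , lower
      where
      lower : ∀ h′ → IsHom A I h′ → Extends A I W a h′ → q ≤ cost A I h′
      lower h′ hom′ ext′ with forced a h′ hom′ ext′
      ... | q″ , v″ , cost≡q″ = ℚ.≤-reflexive (trans (functional a v v″) (sym cost≡q″))
    infeasible : (∀ q → ¬ Val a q) → ¬ Feasible A I W a
    infeasible noVal (h , hom , ext) with forced a h hom ext
    ... | q , v , _ = noVal q v

-- The path of the instances below is the all-zigzag path Q_∅ with the single edges of Q_S added
-- as shortcuts; its homomorphic images are those of Q_S, since a zigzag folds onto a single edge.
record PathImage {V : Set} (Edge : V → V → Set) {n} (S : Fin n → Bool) (s t : V) : Set where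
  field
    junction   : Fin (suc n) → V
    zigA zigB  : Fin n → V
    first      : Edge s (junction zero)
    last       : Edge (junction (fromℕ n)) t
    single     : ∀ l → T (S l) → Edge (junction (inject₁ l)) (junction (suc l))
    zig₁       : ∀ l → Edge (junction (inject₁ l)) (zigA l)
    zig₂       : ∀ l → Edge (zigB l) (zigA l)
    zig₃       : ∀ l → Edge (zigB l) (junction (suc l))

module PathInstance {n : ℕ} (p : ℕ) (S : Fin p → Fin n → Bool) (c : ℚ) (0≤c : 0ℚ ≤ c) where

  -- a nested sum, so that its enumeration by Fin m is assembled from library isomorphisms
  Node : Set
  Node = Fin p ⊎ (⊤ ⊎ ((Fin p × Fin (suc n)) ⊎ ((Fin p × Fin n) ⊎ (Fin p × Fin n))))

  pattern X i    = inj₁ i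
  pattern Y      = inj₂ (inj₁ tt)
  pattern P i k  = inj₂ (inj₂ (inj₁ (i , k)))
  pattern ZA i l = inj₂ (inj₂ (inj₂ (inj₁ (i , l))))
  pattern ZB i l = inj₂ (inj₂ (inj₂ (inj₂ (i , l))))

  data Arc : Node → Node → Set where
    arc-first  : ∀ i → Arc (X i) (P i zero)
    arc-last   : ∀ i → Arc (P i (fromℕ n)) Y
    arc-single : ∀ i l → T (S i l) → Arc (P i (inject₁ l)) (P i (suc l))
    arc-zig₁   : ∀ i l → Arc (P i (inject₁ l)) (ZA i l)
    arc-zig₂   : ∀ i l → Arc (ZB i l) (ZA i l)
    arc-zig₃   : ∀ i l → Arc (ZB i l) (P i (suc l))

  Arc? : ∀ a b → Dec (Arc a b)
  Arc? Y        _        = no λ ()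
  Arc? (ZA _ _) _        = no λ ()
  Arc? _        (X _)    = no λ ()
  Arc? _        (ZB _ _) = no λ ()
  Arc? (X _)    Y        = no λ ()
  Arc? (X _)    (ZA _ _) = no λ ()
  Arc? (ZB _ _) Y        = no λ ()
  Arc? (P _ _)  (P _ zero) = no λ ()
  Arc? (X i) (P j k) =
    map′ (λ { (refl , refl) → arc-first i }) (λ { (arc-first _) → refl , refl }) (j ≟ i ×-dec k ≟ zero)
  Arc? (P i k) Y =
    map′ (λ { refl → arc-last i }) (λ { (arc-last _) → refl }) (k ≟ fromℕ n)
  Arc? (P i k) (P j (suc l)) =
    map′ (λ { (refl , refl , s) → arc-single i l s }) (λ { (arc-single _ _ s) → refl , refl , s })
         (j ≟ i ×-dec k ≟ inject₁ l ×-dec T? (S j l))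
  Arc? (P i k) (ZA j l) =
    map′ (λ { (refl , refl) → arc-zig₁ i l }) (λ { (arc-zig₁ _ _) → refl , refl }) (j ≟ i ×-dec k ≟ inject₁ l)
  Arc? (ZB i l) (ZA j l′) =
    map′ (λ { (refl , refl) → arc-zig₂ i l }) (λ { (arc-zig₂ _ _) → refl , refl }) (j ≟ i ×-dec l′ ≟ l)
  Arc? (ZB i l) (P j k) =
    map′ (λ { (refl , refl) → arc-zig₃ i l }) (λ { (arc-zig₃ _ _) → refl , refl }) (j ≟ i ×-dec k ≟ suc l)

  m : ℕ
  m = p ℕ.+ (1 ℕ.+ (p ℕ.* suc n ℕ.+ (p ℕ.* n ℕ.+ p ℕ.* n)))

  enumeration : Fin m ↔ Node
  enumeration = ↔-trans +↔⊎ (↔-refl ⊎-↔ ↔-trans +↔⊎ (1↔⊤ ⊎-↔ ↔-trans +↔⊎ (*↔× ⊎-↔ ↔-trans +↔⊎ (*↔× ⊎-↔ *↔×))))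

  open Inverse enumeration public using () renaming (to to decode; from to encode; strictlyInverseˡ to decode-encode)

  encode-injective : ∀ {a b} → encode a ≡ encode b → a ≡ b
  encode-injective {a} {b} eq = trans (sym (decode-encode a)) (trans (cong decode eq) (decode-encode b))

  I : Instance
  I = record
    { m = m ; E = λ x y → isYes (Arc? (decode x) (decode y)) ; wE = λ _ _ → 0ℚ
    ; U = λ x → isYes (x ≟ encode Y) ; wU = λ _ → c
    ; wE-nonneg = λ _ _ _ → ℚ.≤-refl ; wU-nonneg = λ _ _ → 0≤c }

  module _ (A : Structure0) where
    open Structure0 A using (Carrier; Edge; Un; wU)

    hom⇒edges : ∀ {h} → IsHom A I h → ∀ {a b} → Arc a b → Edge (h (encode a)) (h (encode b))
    hom⇒edges (edges , _) {a} {b} ab =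
      edges (encode a) (encode b) (fromWitness (subst₂ Arc (sym (decode-encode a)) (sym (decode-encode b)) ab))

    hom⇒pathImage : ∀ {h} → IsHom A I h → ∀ i → PathImage Edge (S i) (h (encode (X i))) (h (encode Y))
    hom⇒pathImage {h} hom i = record
      { junction = λ k → h (encode (P i k)) ; zigA = λ l → h (encode (ZA i l)) ; zigB = λ l → h (encode (ZB i l))
      ; first = hom⇒edges hom (arc-first i) ; last = hom⇒edges hom (arc-last i)
      ; single = λ l s → hom⇒edges hom (arc-single i l s)
      ; zig₁ = λ l → hom⇒edges hom (arc-zig₁ i l) ; zig₂ = λ l → hom⇒edges hom (arc-zig₂ i l)
      ; zig₃ = λ l → hom⇒edges hom (arc-zig₃ i l) }

    pathImages⇒hom : (s : Fin p → Carrier) (t : Carrier) → Un t →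
                     (∀ i → PathImage Edge (S i) (s i) t) →
                     ∃[ h ] IsHom A I h × (∀ i → h (encode (X i)) ≡ s i) × h (encode Y) ≡ t
    pathImages⇒hom s t Un-t π = glued ∘ decode , (edges , units) , (λ i → glued-encode (X i)) , glued-encode Y
      where
      open PathImage
      glued : Node → Carrier
      glued (X i)    = s i
      glued Y        = t
      glued (P i k)  = junction (π i) k
      glued (ZA i l) = zigA (π i) l
      glued (ZB i l) = zigB (π i) l

      glued-edges : ∀ {a b} → Arc a b → Edge (glued a) (glued b)
      glued-edges (arc-first i)      = first (π i)
      glued-edges (arc-last i)       = last (π i)
      glued-edges (arc-single i l s) = single (π i) l s
      glued-edges (arc-zig₁ i l)     = zig₁ (π i) l
      glued-edges (arc-zig₂ i l)     = zig₂ (π i) l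
      glued-edges (arc-zig₃ i l)     = zig₃ (π i) l

      glued-encode : ∀ a → glued (decode (encode a)) ≡ glued a
      glued-encode a = cong glued (decode-encode a)

      edges : ∀ x y → T (isYes (Arc? (decode x) (decode y))) → Edge (glued (decode x)) (glued (decode y))
      edges x y xy = glued-edges (toWitness xy)

      units : ∀ x → T (isYes (x ≟ encode Y)) → Un (glued (decode x))
      units x x≡Y with toWitness x≡Y
      ... | refl = subst Un (sym (glued-encode Y)) Un-t

    cost≡Y-weight : ∀ h → cost A I h ≡ c * wU (h (encode Y))
    cost≡Y-weight h = begin
      cost A I h                                        ≡⟨ cong₂ _+_ edges-free (∑-single m _ (encode Y) off-Y) ⟩
      0ℚ + when (U (encode Y)) (c * wU (h (encode Y)))  ≡⟨ ℚ.+-identityˡ _ ⟩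
      when (U (encode Y)) (c * wU (h (encode Y)))       ≡⟨ at-Y ⟩
      c * wU (h (encode Y))                             ∎
      where
      open ≡-Reasoning
      open Instance I using (E; U)

      edges-free : ∑ m (λ x → ∑ m (λ y → when (E x y) (0ℚ * Structure0.wE A (h x) (h y)))) ≡ 0ℚ
      edges-free = trans (∑-cong m (λ x → trans (∑-cong m (λ y → free (E x y) (Structure0.wE A (h x) (h y)))) (∑-zero m))) (∑-zero m)
        where
        free : ∀ b q → when b (0ℚ * q) ≡ 0ℚ
        free false _ = refl
        free true  q = ℚ.*-zeroˡ q

      off-Y : ∀ x → x ≢ encode Y → when (U x) (c * wU (h x)) ≡ 0ℚ
      off-Y x x≢Y with x ≟ encode Y
      ... | yes x≡Y = ⊥-elim (x≢Y x≡Y)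
      ... | no _    = refl

      at-Y : when (U (encode Y)) (c * wU (h (encode Y))) ≡ c * wU (h (encode Y))
      at-Y with encode Y ≟ encode Y
      ... | yes _   = refl
      ... | no Y≢Y  = ⊥-elim (Y≢Y refl)

module GadgetPaths {d n : ℕ} (R : Vec (Fin d) n → Bool) (ρ : Σ (Vec (Fin d) n) (λ a → T (R a)) → ℚ) where
  open Gadget R ρ

  Fits : (Fin n → Bool) → Fin d → RElem → Set
  Fits S x a = ∀ l → T (S l) → x ≡ lookup (proj₁ a) l

  record CopyBetween (S : Fin n → Bool) (s t : V) : Set where
    field
      origin    : Fin d
      tuple     : RElem
      at-origin : s ≡ dv origin
      at-tuple  : t ≡ rv tuple
      fits      : Fits S origin tuple

  inS⇒≡ : ∀ {x a l} → T (inS x a l) → x ≡ lookup (proj₁ a) l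
  inS⇒≡ {x} {a} {l} t with x ≟ lookup (proj₁ a) l
  ... | yes x≡aₗ = x≡aₗ

  ≡⇒inS : ∀ {x a l} → x ≡ lookup (proj₁ a) l → T (inS x a l)
  ≡⇒inS {x} {a} {l} x≡aₗ rewrite dec-true (x ≟ lookup (proj₁ a) l) x≡aₗ = tt

  lev : V → ℕ
  lev (dv _)       = 0
  lev (pv _ _ k)   = suc (toℕ k)
  lev (zB _ _ l _) = suc (toℕ l)
  lev (zA _ _ l _) = suc (suc (toℕ l))
  lev (rv _)       = suc (suc n)

  lev-edge : ∀ {v w} → Edge v w → lev w ≡ suc (lev v)
  lev-edge (e-first _ _)      = refl
  lev-edge (e-last _ _)       = cong (ℕ.suc ∘ ℕ.suc) (sym (toℕ-fromℕ n))
  lev-edge (e-single _ _ l _) = cong (ℕ.suc ∘ ℕ.suc) (sym (toℕ-inject₁ l))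
  lev-edge (e-zig1 _ _ l _)   = cong (ℕ.suc ∘ ℕ.suc) (sym (toℕ-inject₁ l))
  lev-edge (e-zig2 _ _ _ _)   = refl
  lev-edge (e-zig3 _ _ _ _)   = refl

  lev≤2+n : ∀ v → lev v ℕ.≤ suc (suc n)
  lev≤2+n (dv _)       = ℕ.z≤n
  lev≤2+n (pv _ _ k)   = ℕ.s≤s (ℕₚ.m≤n⇒m≤1+n (toℕ≤pred[n] k))
  lev≤2+n (zB _ _ l _) = ℕ.s≤s (ℕₚ.m≤n⇒m≤1+n (ℕₚ.<⇒≤ (toℕ<n l)))
  lev≤2+n (zA _ _ l _) = ℕ.s≤s (ℕₚ.m≤n⇒m≤1+n (toℕ<n l))
  lev≤2+n (rv _)       = ℕₚ.≤-refl

  lev≡0⇒dv : ∀ v → lev v ≡ 0 → ∃[ x ] v ≡ dv x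
  lev≡0⇒dv (dv x) _ = x , refl

  pv-injective : ∀ {x a k x′ a′ k′} → pv x a k ≡ pv x′ a′ k′ → x ≡ x′ × a ≡ a′ × k ≡ k′
  pv-injective refl = refl , refl , refl

  same-piece : ∀ {x a l x′ a′ l′} → pv x a (inject₁ l) ≡ pv x′ a′ (inject₁ l′) → (x , a , l) ≡ (x′ , a′ , l′)
  same-piece eq with pv-injective eq
  ... | refl , refl , k≡k′ = cong (λ l → _ , _ , l) (inject₁-injective k≡k′)

  -- Piece l of the copy from x to a is a bipartite graph: edges of 𝔻 leaving its sources and
  -- edges entering its targets stay inside it, and zA has no out-edges.
  PieceSource PieceTarget : Fin d → RElem → Fin n → V → Set
  PieceSource x a l w = w ≡ pv x a (inject₁ l) ⊎ ∃[ q ] w ≡ zB x a l q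
  PieceTarget x a l v = v ≡ pv x a (suc l)     ⊎ ∃[ q ] v ≡ zA x a l q

  source→target : ∀ {x a l v w} → PieceSource x a l w → Edge w v → PieceTarget x a l v
  source→target (inj₁ eq) (e-last _ _) = ⊥-elim (fromℕ≢inject₁ (proj₂ (proj₂ (pv-injective eq))))
  source→target (inj₁ eq) (e-single _ _ _ _) with same-piece eq
  ... | refl = inj₁ refl
  source→target (inj₁ eq) (e-zig1 _ _ _ q) with same-piece eq
  ... | refl = inj₂ (q , refl)
  source→target (inj₂ (_ , refl)) (e-zig2 _ _ _ q) = inj₂ (q , refl)
  source→target (inj₂ (_ , refl)) (e-zig3 _ _ _ _) = inj₁ refl

  target←source : ∀ {x a l v w} → PieceTarget x a l v → Edge w v → PieceSource x a l w
  target←source (inj₁ refl) (e-single _ _ _ _) = inj₁ refl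
  target←source (inj₁ refl) (e-zig3 _ _ _ q)   = inj₂ (q , refl)
  target←source (inj₂ (_ , refl)) (e-zig1 _ _ _ _) = inj₁ refl
  target←source (inj₂ (_ , refl)) (e-zig2 _ _ _ q) = inj₂ (q , refl)

  target-with-successor : ∀ {x a l v w} → PieceTarget x a l v → Edge v w → v ≡ pv x a (suc l)
  target-with-successor (inj₁ eq) _ = eq
  target-with-successor (inj₂ (_ , refl)) ()

  edge-from-dv : ∀ {x v} → Edge (dv x) v → ∃[ a ] v ≡ pv x a zero
  edge-from-dv (e-first _ a) = a , refl

  edge-from-last : ∀ {x a v w} → w ≡ pv x a (fromℕ n) → Edge w v → v ≡ rv a
  edge-from-last eq (e-last _ _) with pv-injective eq
  ... | refl , refl , _ = refl
  edge-from-last eq (e-single _ _ _ _) = ⊥-elim (fromℕ≢inject₁ (sym (proj₂ (proj₂ (pv-injective eq)))))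
  edge-from-last eq (e-zig1 _ _ _ _)   = ⊥-elim (fromℕ≢inject₁ (sym (proj₂ (proj₂ (pv-injective eq)))))

  single-edge⇒inS : ∀ {x a l v w} → w ≡ pv x a (inject₁ l) → v ≡ pv x a (suc l) → Edge w v → T (inS x a l)
  single-edge⇒inS eq refl (e-single _ _ _ s) with same-piece eq
  ... | refl = s

  module _ {S : Fin n → Bool} {s t : V} (π : PathImage Edge S s t) where
    open PathImage π

    lev-junction : ∀ k → lev (junction k) ≡ suc (toℕ k ℕ.+ lev s)
    lev-junction = <-weakInduction _ (lev-edge first) step
      where
      open ≡-Reasoning
      step : ∀ l → lev (junction (inject₁ l)) ≡ suc (toℕ (inject₁ l) ℕ.+ lev s) →
             lev (junction (suc l)) ≡ suc (suc (toℕ l ℕ.+ lev s))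
      step l ih = begin
        lev (junction (suc l))               ≡⟨ lev-edge (zig₃ l) ⟩
        suc (lev (zigB l))                   ≡⟨ sym (lev-edge (zig₂ l)) ⟩
        lev (zigA l)                         ≡⟨ lev-edge (zig₁ l) ⟩
        suc (lev (junction (inject₁ l)))     ≡⟨ cong ℕ.suc ih ⟩
        suc (suc (toℕ (inject₁ l) ℕ.+ lev s)) ≡⟨ cong (λ j → suc (suc (j ℕ.+ lev s))) (toℕ-inject₁ l) ⟩
        suc (suc (toℕ l ℕ.+ lev s))          ∎

    -- the path rises n + 2 levels, the full height of 𝔻
    source-in-D : ∃[ x ] s ≡ dv x
    source-in-D = lev≡0⇒dv s (ℕₚ.n≤0⇒n≡0 (ℕₚ.+-cancelˡ-≤ n _ _ n+lev≤n+0))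
      where
      lev-t : lev t ≡ suc (suc (n ℕ.+ lev s))
      lev-t = trans (lev-edge last)
                    (cong ℕ.suc (trans (lev-junction (fromℕ n)) (cong (λ j → suc (j ℕ.+ lev s)) (toℕ-fromℕ n))))
      n+lev≤n+0 : n ℕ.+ lev s ℕ.≤ n ℕ.+ 0
      n+lev≤n+0 = subst (n ℕ.+ lev s ℕ.≤_) (sym (ℕₚ.+-identityʳ n))
                        (ℕₚ.≤-pred (ℕₚ.≤-pred (subst (ℕ._≤ suc (suc n)) lev-t (lev≤2+n t))))

    junction-has-successor : ∀ k → ∃[ w ] Edge (junction k) w
    junction-has-successor = >-weakInduction _ (t , last) (λ l _ → zigA l , zig₁ l)

    pathImage⇒copy : CopyBetween S s t
    pathImage⇒copy with source-in-D
    ... | x , s≡x with edge-from-dv (subst (λ v → Edge v (junction zero)) s≡x first)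
    ...   | a , junction₀ = record
      { origin = x ; tuple = a ; at-origin = s≡x ; at-tuple = edge-from-last (in-copy (fromℕ n)) last ; fits = fits }
      where
      in-copy : ∀ k → junction k ≡ pv x a k
      in-copy = <-weakInduction _ junction₀ step
        where
        step : ∀ l → junction (inject₁ l) ≡ pv x a (inject₁ l) → junction (suc l) ≡ pv x a (suc l)
        step l ih = target-with-successor across-zigzag (proj₂ (junction-has-successor (suc l)))
          where
          across-zigzag : PieceTarget x a l (junction (suc l))
          across-zigzag = source→target (target←source (source→target (inj₁ ih) (zig₁ l)) (zig₂ l)) (zig₃ l)

      fits : Fits S x a
      fits l l∈S = inS⇒≡ {a = a} (single-edge⇒inS (in-copy (inject₁ l)) (in-copy (suc l)) (single l l∈S))

  zigzag-in-copy : ∀ x a l → ∃[ (zA′ , zB′) ]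
    Edge (pv x a (inject₁ l)) zA′ × Edge zB′ zA′ × Edge zB′ (pv x a (suc l))
  zigzag-in-copy x a l with inS x a l in eq
  ... | true  = (pv x a (suc l) , pv x a (inject₁ l)) , single , single , single
    where single = e-single x a l (subst T (sym eq) tt)
  ... | false = (zA x a l q , zB x a l q) , e-zig1 x a l q , e-zig2 x a l q , e-zig3 x a l q
    where q = subst (T ∘ not) (sym eq) tt

  copy⇒pathImage : ∀ {S x a} → Fits S x a → PathImage Edge S (dv x) (rv a)
  copy⇒pathImage {S} {x} {a} fits = record
    { junction = pv x a
    ; zigA = λ l → proj₁ (proj₁ (zigzag-in-copy x a l))
    ; zigB = λ l → proj₂ (proj₁ (zigzag-in-copy x a l))
    ; first = e-first x a ; last = e-last x a
    ; single = λ l l∈S → e-single x a l (≡⇒inS {a = a} (fits l l∈S))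
    ; zig₁ = λ l → proj₁ (proj₂ (zigzag-in-copy x a l))
    ; zig₂ = λ l → proj₁ (proj₂ (proj₂ (zigzag-in-copy x a l)))
    ; zig₃ = λ l → proj₂ (proj₂ (proj₂ (zigzag-in-copy x a l))) }

0≤1 : 0ℚ ≤ 1ℚ
0≤1 = ℚ.nonNegative⁻¹ 1ℚ

module Expressions {d n : ℕ} (R : Vec (Fin d) n → Bool) (ρ : Σ (Vec (Fin d) n) (λ a → T (R a)) → ℚ) where
  open Gadget R ρ
  open GadgetPaths R ρ

  RElem-≡ : ∀ {a b : RElem} → proj₁ a ≡ proj₁ b → a ≡ b
  RElem-≡ {a , a∈R} {_ , b∈R} refl = cong (a ,_) (T-irrelevant a∈R b∈R)

  ρVal-functional : ∀ v {q q′} → ρVal v q → ρVal v q′ → q ≡ q′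
  ρVal-functional v (a , v≡a , ρa≡q) (b , v≡b , ρb≡q′) =
    trans (sym ρa≡q) (trans (cong ρ (RElem-≡ (map-injective dv-injective (trans (sym v≡a) v≡b)))) ρb≡q′)
    where
    dv-injective : ∀ {x y} → dv x ≡ dv y → x ≡ y
    dv-injective refl = refl

  DVal-functional : ∀ v {q q′} → DVal v q → DVal v q′ → q ≡ q′
  DVal-functional _ (_ , _ , q≡0) (_ , _ , q′≡0) = trans q≡0 (sym q′≡0)

  rv-injective : ∀ {a b} → rv a ≡ rv b → a ≡ b
  rv-injective refl = refl

  module _ {p} (S : Fin p → Fin n → Bool) where
    open PathInstance p S 1ℚ 0≤1

    cost-at-R : ∀ h {a} → h (encode Y) ≡ rv a → cost A0 I h ≡ ρ a
    cost-at-R h {a} hY≡a = trans (cost≡Y-weight A0 h) (trans (cong (λ v → 1ℚ * u v) hY≡a) (ℚ.*-identityˡ (ρ a)))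

  ρ-expressible : Fin n → Expressible A0 n ρVal
  ρ-expressible i₀ = I , W , distinct , forcedCost⇒Expresses A0 I W ρVal ρVal-functional forced feasible
    where
    S : Fin n → Fin n → Bool
    S i l = isYes (i ≟ l)
    open PathInstance n S 1ℚ 0≤1

    W : Vec (Fin m) n
    W = tabulate (encode ∘ X)

    distinct : Distinct A0 I W
    distinct i j Wi≡Wj = X-injective (encode-injective
      (trans (sym (lookup∘tabulate (encode ∘ X) i)) (trans Wi≡Wj (lookup∘tabulate (encode ∘ X) j))))
      where
      X-injective : ∀ {i j} → _≡_ {A = Node} (X i) (X j) → i ≡ j
      X-injective refl = refl

    forced : ∀ a h → IsHom A0 I h → Extends A0 I W a h → ∃[ q ] ρVal a q × cost A0 I h ≡ q
    forced a h hom ext = ρ r , (r , a≡r , refl) , cost-at-R S h (CopyBetween.at-tuple (copy i₀))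
      where
      open ≡-Reasoning
      copy : ∀ i → CopyBetween (S i) (h (encode (X i))) (h (encode Y))
      copy i = pathImage⇒copy (hom⇒pathImage A0 hom i)

      r : RElem
      r = CopyBetween.tuple (copy i₀)

      coordinate : ∀ i → lookup a i ≡ lookup (map dv (proj₁ r)) i
      coordinate i = begin
        lookup a i                   ≡⟨ sym (ext i) ⟩
        h (lookup W i)               ≡⟨ cong h (lookup∘tabulate (encode ∘ X) i) ⟩
        h (encode (X i))             ≡⟨ at-origin ⟩
        dv origin                    ≡⟨ cong dv (fits i (fromWitness refl)) ⟩
        dv (lookup (proj₁ tuple) i)  ≡⟨ cong (λ r′ → dv (lookup (proj₁ r′) i)) tuple≡r ⟩
        dv (lookup (proj₁ r) i)      ≡⟨ sym (lookup-map i dv (proj₁ r)) ⟩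
        lookup (map dv (proj₁ r)) i  ∎
        where
        open CopyBetween (copy i)
        tuple≡r : tuple ≡ r
        tuple≡r = rv-injective (trans (sym at-tuple) (CopyBetween.at-tuple (copy i₀)))

      a≡r : a ≡ map dv (proj₁ r)
      a≡r = trans (sym (tabulate∘lookup a)) (trans (tabulate-cong coordinate) (tabulate∘lookup _))

    feasible : ∀ a {q} → ρVal a q → Feasible A0 I W a
    feasible a (r , a≡r , _) with pathImages⇒hom A0 (dv ∘ lookup (proj₁ r)) (rv r) tt (copy⇒pathImage ∘ fits)
      where
      fits : ∀ i → Fits (S i) (lookup (proj₁ r) i) r
      fits i l i≡l = cong (lookup (proj₁ r)) (toWitness i≡l)
    ... | h , hom , hX , _ = h , hom , λ i → begin
      h (lookup W i)               ≡⟨ cong h (lookup∘tabulate (encode ∘ X) i) ⟩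
      h (encode (X i))             ≡⟨ hX i ⟩
      dv (lookup (proj₁ r) i)      ≡⟨ sym (lookup-map i dv (proj₁ r)) ⟩
      lookup (map dv (proj₁ r)) i  ≡⟨ cong (λ v → lookup v i) (sym a≡r) ⟩
      lookup a i                   ∎
      where open ≡-Reasoning

  D-expressible : RElem → Expressible A0 1 DVal
  D-expressible r = I , [ encode (X zero) ] , singleton-distinct {A0} {I}
                  , forcedCost⇒Expresses A0 I [ encode (X zero) ] DVal DVal-functional forced feasible
    where
    open PathInstance 1 (λ _ _ → false) 0ℚ ℚ.≤-refl

    forced : ∀ a h → IsHom A0 I h → Extends A0 I [ encode (X zero) ] a h → ∃[ q ] DVal a q × cost A0 I h ≡ q
    forced (v ∷ []) h hom ext =
      0ℚ , (origin , cong [_] (trans (sym (ext zero)) at-origin) , refl) , trans (cost≡Y-weight A0 h) (ℚ.*-zeroˡ (u (h (encode Y))))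
      where open CopyBetween (pathImage⇒copy (hom⇒pathImage A0 hom zero))

    feasible : ∀ a {q} → DVal a q → Feasible A0 I [ encode (X zero) ] a
    feasible _ (x , refl , _) with pathImages⇒hom A0 (λ _ → dv x) (rv r) tt (λ _ → copy⇒pathImage (λ _ ()))
    ... | h , hom , hX , _ = h , hom , λ { zero → hX zero }

  D-expressible-R-empty : (∀ a → ¬ T (R a)) → Expressible A0 1 DVal
  D-expressible-R-empty R-empty = I , [ encode Y ] , singleton-distinct {A0} {I}
                                , forcedCost⇒Expresses A0 I [ encode Y ] DVal DVal-functional forced feasible
    where
    open PathInstance {n} 0 (λ ()) 0ℚ ℚ.≤-refl

    V-is-D : ∀ v → ∃[ x ] v ≡ dv x
    V-is-D (dv x)               = x , refl
    V-is-D (rv (a , a∈R))       = ⊥-elim (R-empty a a∈R)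
    V-is-D (pv _ (a , a∈R) _)   = ⊥-elim (R-empty a a∈R)
    V-is-D (zA _ (a , a∈R) _ _) = ⊥-elim (R-empty a a∈R)
    V-is-D (zB _ (a , a∈R) _ _) = ⊥-elim (R-empty a a∈R)

    forced : ∀ a h → IsHom A0 I h → Extends A0 I [ encode Y ] a h → ∃[ q ] DVal a q × cost A0 I h ≡ q
    forced (v ∷ []) h _ _ =
      0ℚ , (proj₁ (V-is-D v) , cong [_] (proj₂ (V-is-D v)) , refl) , trans (cost≡Y-weight A0 h) (ℚ.*-zeroˡ (u (h (encode Y))))

    feasible : ∀ a {q} → DVal a q → Feasible A0 I [ encode Y ] a
    feasible _ (x , refl , _) with pathImages⇒hom A0 (λ ()) (dv x) tt (λ ())
    ... | h , hom , _ , hY = h , hom , λ { zero → hY }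

module Nullary {d : ℕ} (R : Vec (Fin d) 0 → Bool) (ρ : Σ (Vec (Fin d) 0) (λ a → T (R a)) → ℚ) where
  open Gadget R ρ
  open GadgetPaths R ρ
  open Expressions R ρ

  module _ {p} (S : Fin p → Fin 0 → Bool) where
    open PathInstance p S 1ℚ 0≤1

    ρ-expressible-by-Y : (∀ {h} → IsHom A0 I h → ∃[ r ] h (encode Y) ≡ rv r) →
                         (RElem → ∃[ h ] IsHom A0 I h) → Expressible A0 0 ρVal
    ρ-expressible-by-Y Y-in-R hom-to = I , [] , (λ ()) , forcedCost⇒Expresses A0 I [] ρVal ρVal-functional forced feasible
      where
      forced : ∀ a h → IsHom A0 I h → Extends A0 I [] a h → ∃[ q ] ρVal a q × cost A0 I h ≡ q
      forced [] h hom _ = ρ r , (r , []≡map , refl) , cost-at-R S h (proj₂ (Y-in-R hom))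
        where
        r : RElem
        r = proj₁ (Y-in-R hom)
        []≡map : [] ≡ map dv (proj₁ r)
        []≡map with proj₁ r
        ... | [] = refl

      feasible : ∀ a {q} → ρVal a q → Feasible A0 I [] a
      feasible [] (r , _ , _) = proj₁ (hom-to r) , proj₂ (hom-to r) , λ ()

  ρ-expressible-D-inhabited : Fin d → Expressible A0 0 ρVal
  ρ-expressible-D-inhabited x₀ = ρ-expressible-by-Y {1} S Y-in-R hom-to
    where
    S : Fin 1 → Fin 0 → Bool
    S _ ()
    open PathInstance 1 S 1ℚ 0≤1
    Y-in-R : ∀ {h} → IsHom A0 I h → ∃[ r ] h (encode Y) ≡ rv r
    Y-in-R hom = tuple , at-tuple
      where open CopyBetween (pathImage⇒copy (hom⇒pathImage A0 hom zero))
    hom-to : RElem → ∃[ h ] IsHom A0 I h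
    hom-to r with pathImages⇒hom A0 (λ _ → dv x₀) (rv r) tt (λ _ → copy⇒pathImage (λ ()))
    ... | h , hom , _ = h , hom

module NullaryEmptyD (R : Vec (Fin 0) 0 → Bool) (ρ : Σ (Vec (Fin 0) 0) (λ a → T (R a)) → ℚ) where
  open Gadget R ρ
  open Nullary R ρ

  ρ-expressible-D-empty : Expressible A0 0 ρVal
  ρ-expressible-D-empty = ρ-expressible-by-Y {0} (λ ()) (λ {h} _ → V-is-R (h (encode Y))) hom-to
    where
    open PathInstance {0} 0 (λ ()) 1ℚ 0≤1
    V-is-R : ∀ v → ∃[ r ] v ≡ rv r
    V-is-R (rv r) = r , refl
    hom-to : RElem → ∃[ h ] IsHom A0 I h
    hom-to r with pathImages⇒hom A0 (λ ()) (rv r) tt (λ ())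
    ... | h , hom , _ = h , hom

∃-vec? : ∀ {d} n (P : Vec (Fin d) n → Bool) → Dec (∃[ v ] T (P v))
∃-vec? zero    P = map′ ([] ,_) (λ { ([] , t) → t }) (T? (P []))
∃-vec? (suc n) P = map′ (λ { (x , v , t) → x ∷ v , t }) (λ { (x ∷ v , t) → x , v , t })
                        (any? λ x → ∃-vec? n (P ∘ (x ∷_)))

ρVal-expressible : ∀ d n (R : Vec (Fin d) n → Bool) (ρ : Σ (Vec (Fin d) n) (λ a → T (R a)) → ℚ) →
                   Expressible (Gadget.A0 R ρ) n (Gadget.ρVal R ρ)
ρVal-expressible d       (suc n) R ρ = Expressions.ρ-expressible R ρ zero
ρVal-expressible (suc d) zero    R ρ = Nullary.ρ-expressible-D-inhabited R ρ zero
ρVal-expressible zero    zero    R ρ = NullaryEmptyD.ρ-expressible-D-empty R ρ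

DVal-expressible : ∀ d n (R : Vec (Fin d) n → Bool) (ρ : Σ (Vec (Fin d) n) (λ a → T (R a)) → ℚ) →
                   Expressible (Gadget.A0 R ρ) 1 (Gadget.DVal R ρ)
DVal-expressible d n R ρ with ∃-vec? n R
... | yes r       = Expressions.D-expressible R ρ r
... | no R-empty  = Expressions.D-expressible-R-empty R ρ (λ a a∈R → R-empty (a , a∈R))

mainTheorem3 : (d n : ℕ) (R : Vec (Fin d) n → Bool)
    (ρ : Σ (Vec (Fin d) n) (λ a → T (R a)) → ℚ) →
    (∀ a → 0ℚ ≤ ρ a) →
    Expressible (Gadget.A0 R ρ) n (Gadget.ρVal R ρ)
    × Expressible (Gadget.A0 R ρ) 1 (Gadget.DVal R ρ)
mainTheorem3 d n R ρ _ = ρVal-expressible d n R ρ , DVal-expressible d n R ρ
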